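{- For every term $M$ of the (restricted) call-by-value $\lambda\Box$-calculus, if $x_1:\sigma_1,\dots,x_n:\sigma_n\vdash M:\tau$, then $x_1:\sigma_1^*,\dots,x_n:\sigma_n^*\vdash[\![M]\!]:(\tau^*\supset R)\supset R$ in the call-by-name $\lambda\Box$-calculus.
   Context: Types: $\sigma::=p\mid\sigma\supset\sigma\mid\Box\sigma$. Typing rules (shared by both calculi): - $\Gamma\vdash c^\tau:\tau$; - $\Gamma,x:\tau,\Gamma'\vdash x:\tau$; - the usual $\lambda$ and application rules; - from $x_1:\sigma_1,\dots,x_n:\sigma_n\vdash M:\tau$ and $\Gamma\vdash N_i:\Box\sigma_i$ infer $\Gamma\vdash\mathbf{box}_{\vec x}(\vec N;M):\Box\tau$. In a box term $\mathbf{box}_{\vec x}(\vec N;M)$ the $x_i$ are bound in $M$, and its free variables are those of the $N_i$. Call-by-name terms: $M::=c\mid x\mid\lambda x^\sigma.M\mid MM\mid\mathbf{box}_{\vec x}(\vec N;M)$. Restricted call-by-value terms: $M::=c\mid x\mid\lambda x^\sigma.M\mid MM\mid\mathbf{box}_{\vec x}(M_1,\dots,M_n;V)$, with values $V::=c\mid x\mid\lambda x.M\mid\mathbf{box}_{\vec x}(V_1,\dots,V_n;M)$. CPS transformation. $R$ is a fixed type constant. A constant $c$ of type $\tau$ is regarded in the target as a constant of type $\tau^*$. $\vec N(\lambda\vec y.M)$ abbreviates $N_1(\lambda y_1.\cdots N_n(\lambda y_n.M)\cdots)$, and $k,y$ are fresh. Types: - $p^*=p$; - $(\sigma\supset\tau)^*=(\tau^*\supset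 R)\supset\sigma^*\supset R$; - $(\Box\sigma)^*=\Box\sigma^*$. Value transformation $\Phi$: - $\Phi(x)=x$, $\Phi(c)=c$; - $\Phi(\lambda x.M)=\lambda k.\lambda x.[\![M]\!]k$; - $\Phi(\mathbf{box}_{\vec x}(\vec U;V))=\mathbf{box}_{\vec x}(\Phi(\vec U);\Phi(V))$. Term transformation: - $[\![x]\!]=\lambda k.kx$, $[\![c]\!]=\lambda k.kc$; - $[\![\lambda x.M]\!]=\lambda k.k\,\Phi(\lambda x.M)$; - $[\![MN]\!]=\lambda k.[\![M]\!](\lambda y.[\![N]\!](yk))$; - $[\![\mathbf{box}_{\vec x}(\vec M;V)]\!]=\lambda k.[\![\vec M]\!](\lambda\vec y.k\,\mathbf{box}_{\vec x}(\vec y;\Phi(V)))$. -}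

module Defs where

open import Data.Nat using (ℕ; zero; suc; _<ᵇ_; _∸_)
open import Data.Bool using (if_then_else_)
open import Data.List using (List; []; _∷_; map)

infixr 7 _⊃_
data Ty : Set where
  atom : ℕ → Ty
  _⊃_  : Ty → Ty → Ty
  □_   : Ty → Ty

-- Raw terms (de Bruijn indices, Curry-style λ).
--   con n τ    : the constant c_n^τ
--   var i      : de Bruijn variable
--   lam M      : λx.M
--   app M N    : M N
--   box Ns M   : box_x⃗(N⃗ ; M); the x⃗ are the ONLY variables of M
--                (M is typed in the context of the box-bound variables),
--                the i-th element of Ns is the argument for the i-th
--                variable of that context (head of the context = var 0).

data Tm : Set where
  con : ℕ → Ty → Tm
  var : ℕ → Tm
  lam : Tm → Tm
  app : Tm → Tm → Tm
  box : List Tm → Tm → Tm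

Ctx : Set
Ctx = List Ty

data _∋_∶_ : Ctx → ℕ → Ty → Set where
  here  : ∀ {Γ σ} → (σ ∷ Γ) ∋ zero ∶ σ
  there : ∀ {Γ σ τ i} → Γ ∋ i ∶ τ → (σ ∷ Γ) ∋ suc i ∶ τ

-- Typing of the λ□-calculus (shared by both calculi).
infix 4 _⊢_∶_ _⊢*_∶□_
mutual
  data _⊢_∶_ : Ctx → Tm → Ty → Set where
    ⊢con : ∀ {Γ n τ} → Γ ⊢ con n τ ∶ τ
    ⊢var : ∀ {Γ i τ} → Γ ∋ i ∶ τ → Γ ⊢ var i ∶ τ
    ⊢lam : ∀ {Γ M σ τ} → (σ ∷ Γ) ⊢ M ∶ τ → Γ ⊢ lam M ∶ σ ⊃ τ
    ⊢app : ∀ {Γ M N σ τ} → Γ ⊢ M ∶ σ ⊃ τ → Γ ⊢ N ∶ σ → Γ ⊢ app M N ∶ τ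
    ⊢box : ∀ {Γ Ns M τ} (Δ : Ctx) → Γ ⊢* Ns ∶□ Δ → Δ ⊢ M ∶ τ →
           Γ ⊢ box Ns M ∶ □ τ

  data _⊢*_∶□_ : Ctx → List Tm → Ctx → Set where
    []  : ∀ {Γ} → Γ ⊢* [] ∶□ []
    _∷_ : ∀ {Γ N Ns σ Δ} → Γ ⊢ N ∶ □ σ → Γ ⊢* Ns ∶□ Δ →
          Γ ⊢* (N ∷ Ns) ∶□ (σ ∷ Δ)

mutual
  data CBV : Tm → Set where
    cbv-con : ∀ {n τ} → CBV (con n τ)
    cbv-var : ∀ {i} → CBV (var i)
    cbv-lam : ∀ {M} → CBV M → CBV (lam M)
    cbv-app : ∀ {M N} → CBV M → CBV N → CBV (app M N)
    cbv-box : ∀ {Ms V} → AllCBV Ms → Value V → CBV (box Ms V)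

  data AllCBV : List Tm → Set where
    []  : AllCBV []
    _∷_ : ∀ {M Ms} → CBV M → AllCBV Ms → AllCBV (M ∷ Ms)

  data Value : Tm → Set where
    val-con : ∀ {n τ} → Value (con n τ)
    val-var : ∀ {i} → Value (var i)
    val-lam : ∀ {M} → CBV M → Value (lam M)
    val-box : ∀ {Vs V} → AllValue Vs → Value V → Value (box Vs V)

  data AllValue : List Tm → Set where
    []  : AllValue []
    _∷_ : ∀ {V Vs} → Value V → AllValue Vs → AllValue (V ∷ Vs)

-- Weakening: shift c M  inserts a fresh variable at position c.
-- Box bodies are untouched (their only free variables are box-bound).

mutual
  shift : ℕ → Tm → Tm
  shift c (con n τ) = con n τ
  shift c (var i)   = if i <ᵇ c then var i else var (suc i)
  shift c (lam M)   = lam (shift (suc c) M)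
  shift c (app M N) = app (shift c M) (shift c N)
  shift c (box Ns M) = box (shiftList c Ns) M

  shiftList : ℕ → List Tm → List Tm
  shiftList c []       = []
  shiftList c (N ∷ Ns) = shift c N ∷ shiftList c Ns

wk : ℕ → Tm → Tm
wk zero    M = M
wk (suc d) M = shift 0 (wk d M)

module CPS (R : Ty) where

  _* : Ty → Ty
  atom p * = atom p
  (σ ⊃ τ) * = ((τ *) ⊃ R) ⊃ (σ *) ⊃ R
  (□ σ) * = □ (σ *)

  -- y₁ … y_d  where y_i = var (d ∸ i)
  ys : ℕ → ℕ → List Tm
  ys d zero    = []
  ys d (suc m) = var m ∷ ys d m

  ysOf : ℕ → List Tm
  ysOf d = ys d d

  mutual
    -- value transformation Φ (the app case never arises on values)
    Φ : Tm → Tm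
    Φ (con n τ)  = con n (τ *)
    Φ (var i)    = var i
    Φ (lam M)    = lam (lam (app (shift 1 ⟦ M ⟧) (var 1)))
    Φ (app M N)  = app M N
    Φ (box Us V) = box (ΦList Us) (Φ V)

    ΦList : List Tm → List Tm
    ΦList []       = []
    ΦList (U ∷ Us) = Φ U ∷ ΦList Us

    ⟦_⟧ : Tm → Tm
    ⟦ con n τ ⟧  = lam (app (var 0) (con n (τ *)))
    ⟦ var i ⟧    = lam (app (var 0) (var (suc i)))
    ⟦ lam M ⟧    = lam (app (var 0) (shift 0 (Φ (lam M))))
    ⟦ app M N ⟧  = lam (app (shift 0 ⟦ M ⟧)
                            (lam (app (wk 2 ⟦ N ⟧) (app (var 0) (var 1)))))
    ⟦ box Ms V ⟧ = lam (cpsBox (Φ V) 0 Ms)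

    -- in context Γ , k , y₁ , … , y_d :
    --   ⟦M_{d+1}⟧ (λ y_{d+1}. … ⟦Mₙ⟧(λ yₙ. k box_x⃗(y⃗ ; Φ V)) …)
    cpsBox : Tm → ℕ → List Tm → Tm
    cpsBox ΦV d []       = app (var d) (box (ysOf d) ΦV)
    cpsBox ΦV d (M ∷ Ms) = app (wk (suc d) ⟦ M ⟧) (lam (cpsBox ΦV (suc d) Ms))

-- Simultaneous induction on typing derivations: ⟦ M ⟧ gets (τ * ⊃ R) ⊃ R,
-- Φ V gets τ * for values V, and the continuation chain cpsBox of a box whose
-- first d arguments are already evaluated gets R in the context extended by k
-- and the results y₁ … y_d.  Beyond that, only weakening (for the shifts under
-- binders) and the reversed order of the yᵢ in the context need tracking.
module Submission where

open import Defs
open import Data.Nat using (ℕ; zero; suc; _+_; _<ᵇ_)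
open import Data.Nat.Properties using (+-suc; +-comm; +-identityʳ)
open import Data.Bool.Properties using (if-float)
open import Data.List using (List; []; _∷_; map; _++_; _ʳ++_; length; reverse)
open import Data.List.Properties
  using (length-map; length-++; length-reverse; map-++; ++-assoc; ++-identityʳ; ++-ʳ++; ʳ++-defn)
open import Relation.Binary.PropositionalEquality
  using (_≡_; refl; sym; trans; cong; subst; subst₂)

∋-map : ∀ (f : Ty → Ty) {Γ i τ} → Γ ∋ i ∶ τ → map f Γ ∋ i ∶ f τ
∋-map f here      = here
∋-map f (there p) = there (∋-map f p)

∋-≡ : ∀ {Γ i j τ} → i ≡ j → Γ ∋ i ∶ τ → Γ ∋ j ∶ τ
∋-≡ refl p = p

∋-ʳ++ : ∀ xs {Γ i τ} → Γ ∋ i ∶ τ → (xs ʳ++ Γ) ∋ i + length xs ∶ τ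
∋-ʳ++ []       {i = i} p = ∋-≡ (sym (+-identityʳ i)) p
∋-ʳ++ (x ∷ xs) {i = i} p =
  ∋-≡ (sym (+-suc i (length xs))) (∋-ʳ++ xs (there p))

shiftIdx : ℕ → ℕ → ℕ
shiftIdx zero    i       = suc i
shiftIdx (suc c) zero    = zero
shiftIdx (suc c) (suc i) = suc (shiftIdx c i)

shift-var : ∀ c i → shift c (var i) ≡ var (shiftIdx c i)
shift-var zero    i       = refl
shift-var (suc c) zero    = refl
shift-var (suc c) (suc i) =
  trans (sym (if-float (shift 0) (i <ᵇ c))) (cong (shift 0) (shift-var c i))

shiftIdx-∋ : ∀ Γ₁ σ {Γ₂ i τ} → (Γ₁ ++ Γ₂) ∋ i ∶ τ →
             (Γ₁ ++ σ ∷ Γ₂) ∋ shiftIdx (length Γ₁) i ∶ τ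
shiftIdx-∋ []       σ p         = there p
shiftIdx-∋ (_ ∷ Γ₁) σ here      = here
shiftIdx-∋ (_ ∷ Γ₁) σ (there p) = there (shiftIdx-∋ Γ₁ σ p)

mutual
  shift-⊢ : ∀ Γ₁ σ {Γ₂ M τ} → Γ₁ ++ Γ₂ ⊢ M ∶ τ →
            Γ₁ ++ σ ∷ Γ₂ ⊢ shift (length Γ₁) M ∶ τ
  shift-⊢ Γ₁ σ ⊢con                = ⊢con
  shift-⊢ Γ₁ σ (⊢var {i = i} p)    =
    subst (λ t → _ ⊢ t ∶ _) (sym (shift-var (length Γ₁) i)) (⊢var (shiftIdx-∋ Γ₁ σ p))
  shift-⊢ Γ₁ σ (⊢lam {σ = σ′} d)   = ⊢lam (shift-⊢ (σ′ ∷ Γ₁) σ d)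
  shift-⊢ Γ₁ σ (⊢app d e)          = ⊢app (shift-⊢ Γ₁ σ d) (shift-⊢ Γ₁ σ e)
  shift-⊢ Γ₁ σ (⊢box Δ ds d)       = ⊢box Δ (shiftList-⊢* Γ₁ σ ds) d

  shiftList-⊢* : ∀ Γ₁ σ {Γ₂ Ns Δ} → Γ₁ ++ Γ₂ ⊢* Ns ∶□ Δ →
                 Γ₁ ++ σ ∷ Γ₂ ⊢* shiftList (length Γ₁) Ns ∶□ Δ
  shiftList-⊢* Γ₁ σ []       = []
  shiftList-⊢* Γ₁ σ (d ∷ ds) = shift-⊢ Γ₁ σ d ∷ shiftList-⊢* Γ₁ σ ds

wk-⊢ : ∀ Δ {Γ M τ} → Γ ⊢ M ∶ τ → Δ ++ Γ ⊢ wk (length Δ) M ∶ τ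
wk-⊢ []      d = d
wk-⊢ (σ ∷ Δ) d = shift-⊢ [] σ (wk-⊢ Δ d)

wkʳ-⊢ : ∀ Δ {Γ M τ} → Γ ⊢ M ∶ τ → Δ ʳ++ Γ ⊢ wk (length Δ) M ∶ τ
wkʳ-⊢ Δ {M = M} {τ} d =
  subst₂ (λ Γ′ n → Γ′ ⊢ wk n M ∶ τ) (sym (ʳ++-defn Δ)) (length-reverse Δ) (wk-⊢ (reverse Δ) d)

module Typing (r : ℕ) where
  open CPS (atom r)

  R : Ty
  R = atom r

  -- ys d m = var (m - 1) ∷ … ∷ var 0 does not depend on d.
  ys-⊢* : ∀ d Δ {Γ} → map □_ Δ ʳ++ Γ ⊢* ys d (length Δ) ∶□ Δ
  ys-⊢* d []      = []
  ys-⊢* d (σ ∷ Δ) =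
    ⊢var (∋-≡ (length-map □_ Δ) (∋-ʳ++ (map □_ Δ) here)) ∷ ys-⊢* d Δ

  mutual
    ⟦⟧-⊢ : ∀ {Γ M τ} → CBV M → Γ ⊢ M ∶ τ → map _* Γ ⊢ ⟦ M ⟧ ∶ (τ * ⊃ R) ⊃ R
    ⟦⟧-⊢ cbv-con       ⊢con       = ⊢lam (⊢app (⊢var here) ⊢con)
    ⟦⟧-⊢ cbv-var       (⊢var p)   = ⊢lam (⊢app (⊢var here) (⊢var (there (∋-map _* p))))
    ⟦⟧-⊢ (cbv-lam c)   (⊢lam d)   = ⊢lam (⊢app (⊢var here) (shift-⊢ [] _ (Φλ-⊢ c d)))
    ⟦⟧-⊢ (cbv-app c e) (⊢app d f) =
      ⊢lam (⊢app (shift-⊢ [] _ (⟦⟧-⊢ c d))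
                 (⊢lam (⊢app (wk-⊢ (_ ∷ _ ∷ []) (⟦⟧-⊢ e f))
                             (⊢app (⊢var here) (⊢var (there here))))))
    ⟦⟧-⊢ (cbv-box cs v) (⊢box _ ds d) = ⊢lam (cpsBox-⊢ [] cs ds (Φ-⊢ v d))

    Φλ-⊢ : ∀ {Γ M σ τ} → CBV M → σ ∷ Γ ⊢ M ∶ τ → map _* Γ ⊢ Φ (lam M) ∶ (σ ⊃ τ) *
    Φλ-⊢ c d = ⊢lam (⊢lam (⊢app (shift-⊢ (_ ∷ []) _ (⟦⟧-⊢ c d)) (⊢var (there here))))

    Φ-⊢ : ∀ {Γ V τ} → Value V → Γ ⊢ V ∶ τ → map _* Γ ⊢ Φ V ∶ τ *
    Φ-⊢ val-con        ⊢con          = ⊢con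
    Φ-⊢ val-var        (⊢var p)      = ⊢var (∋-map _* p)
    Φ-⊢ (val-lam c)    (⊢lam d)      = Φλ-⊢ c d
    Φ-⊢ (val-box vs v) (⊢box Δ ds d) = ⊢box (map _* Δ) (ΦList-⊢* vs ds) (Φ-⊢ v d)

    ΦList-⊢* : ∀ {Γ Vs Δ} → AllValue Vs → Γ ⊢* Vs ∶□ Δ → map _* Γ ⊢* ΦList Vs ∶□ map _* Δ
    ΦList-⊢* []       []       = []
    ΦList-⊢* (v ∷ vs) (d ∷ ds) = Φ-⊢ v d ∷ ΦList-⊢* vs ds

    -- Done holds the translated types of the box arguments evaluated so far;
    -- their results y₁ … y_d are bound, innermost last, inside k.
    cpsBox-⊢ : ∀ {Γ Ms Rest ΦV τ} Done → AllCBV Ms → Γ ⊢* Ms ∶□ Rest →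
               Done ++ map _* Rest ⊢ ΦV ∶ τ →
               map □_ Done ʳ++ (□ τ ⊃ R) ∷ map _* Γ ⊢ cpsBox ΦV (length Done) Ms ∶ R
    cpsBox-⊢ {ΦV = ΦV} {τ} Done [] [] dV =
      ⊢app (⊢var k∈) (⊢box Done (ys-⊢* (length Done) Done)
                                (subst (λ Δ → Δ ⊢ ΦV ∶ τ) (++-identityʳ Done) dV))
      where
        k∈ : (map □_ Done ʳ++ (□ τ ⊃ R) ∷ _) ∋ length Done ∶ (□ τ ⊃ R)
        k∈ = ∋-≡ (length-map □_ Done) (∋-ʳ++ (map □_ Done) here)
    cpsBox-⊢ {Γ} {M ∷ Ms} {σ ∷ Rest} {ΦV} {τ} Done (c ∷ cs) (d ∷ ds) dV = ⊢app ⊢⟦M⟧ (⊢lam ⊢rest)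
      where
        Γk : Ctx
        Γk = (□ τ ⊃ R) ∷ map _* Γ

        ⊢⟦M⟧ : map □_ Done ʳ++ Γk ⊢ wk (suc (length Done)) ⟦ M ⟧ ∶ (□ (σ *) ⊃ R) ⊃ R
        ⊢⟦M⟧ = subst (λ n → map □_ Done ʳ++ Γk ⊢ wk (suc n) ⟦ M ⟧ ∶ (□ (σ *) ⊃ R) ⊃ R)
                     (length-map □_ Done) (wkʳ-⊢ ((□ τ ⊃ R) ∷ map □_ Done) (⟦⟧-⊢ c d))

        context-snoc : map □_ (Done ++ σ * ∷ []) ʳ++ Γk ≡ □ (σ *) ∷ map □_ Done ʳ++ Γk
        context-snoc = trans (cong (_ʳ++ Γk) (map-++ □_ Done _)) (++-ʳ++ (map □_ Done))

        length-snoc : length (Done ++ σ * ∷ []) ≡ suc (length Done)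
        length-snoc = trans (length-++ Done) (+-comm (length Done) 1)

        ⊢rest : □ (σ *) ∷ map □_ Done ʳ++ Γk ⊢ cpsBox ΦV (suc (length Done)) Ms ∶ R
        ⊢rest = subst₂ (λ Γ′ n → Γ′ ⊢ cpsBox ΦV n Ms ∶ R) context-snoc length-snoc
                       (cpsBox-⊢ (Done ++ σ * ∷ []) cs ds
                                 (subst (λ Δ → Δ ⊢ ΦV ∶ τ) (sym (++-assoc Done _ _)) dV))

proposition5 : (r : ℕ) → let open CPS (atom r) in
    (Γ : List Ty) (M : Tm) (τ : Ty) → CBV M → Γ ⊢ M ∶ τ →
    map _* Γ ⊢ ⟦ M ⟧ ∶ ((τ *) ⊃ atom r) ⊃ atom r
proposition5 r Γ M τ = Typing.⟦⟧-⊢ r
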